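{- Let $P$ be a predicate on $\mathbb{P}^* \times \mathbb{P} \times \mathbb{P} \times \mathbb{P}^*$ that is compatible with relabeling and compatible with subwords. Then the equivalence relation $\equiv_P$ is a nonsymmetric operad congruence of $\mathsf{PAs}^{\leftarrow}$: for every $n,m \geq 1$, all $u,u' \in \mathfrak{P}[n]$ with $u \equiv_P u'$, all $v,v' \in \mathfrak{P}[m]$ with $v \equiv_P v'$, and all $i \in [n]$, one has $u \circ_i v \equiv_P u' \circ_i v'$.
   Context: $\mathbb{P}=\{1,2,\dots\}$, $\mathbb{P}^*$ is the set of words over $\mathbb{P}$, $\epsilon$ the empty word. A packed word is a word whose set of letters is $[k]=\{1,\dots,k\}$ for some $k$; $\mathfrak{P}[n]$ is the set of packed words with set of letters exactly $[n]$. $\mathrm{inc}_{\alpha,\beta}(u)$ adds $\alpha$ to each letter of $u$ strictly greater than $\beta$. The set-operad $\mathsf{PAs}^{\leftarrow}$: its elements of arity $n$ are the words in $\mathfrak{P}[n]$, and for $u\in\mathfrak{P}[n]$, $i\in[n]$, $v\in\mathfrak{P}[m]$, $u\circ_i v$ is the word obtained from $\mathrm{inc}_{m-1,i}(u)$ by replacing every occurrence of $i$ by $\mathrm{inc}_{i-1,0}(v)$. Given a predicate $P$, let $\leftrightarrow$ be the relation on $\mathbb{P}^*$ with $uabv \leftrightarrow ubav$ for all $u,v\in\mathbb{P}^*$, $a,b \in \mathbb{P}$ such that $P(u,a,b,v)$ holds, and let $\equiv_P$ be the reflexive, symmetric and transitive closure of $\leftrightarrow$. $P$ is compatible with relabeling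 if $P(u,a,b,v)$ implies $P(f(u),f(a),f(b),f(v))$ for every strictly increasing map $f:\mathbb{P}\to\mathbb{P}$ (applied letterwise to words). $P$ is compatible with subwords if $P(u,a,b,v)$ implies $P(u',a,b,v')$ whenever $u$ is a subword (subsequence) of $u'$ and $v$ is a subword of $v'$. -}

module Defs where

open import Data.Nat using (ℕ; zero; suc; _+_; _∸_; _≤_; _<_; _<ᵇ_; _≡ᵇ_)
open import Data.Bool using (Bool; true; false; if_then_else_)
open import Data.List using (List; []; _∷_; _++_; map; concatMap)
open import Data.List.Relation.Unary.All using (All)
open import Data.List.Membership.Propositional using (_∈_)
open import Data.List.Relation.Binary.Sublist.Propositional
  using () renaming (_⊆_ to _⊑_)
open import Data.Product using (_×_)
open import Relation.Binary.Construct.Closure.Equivalence using (EqClosure)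

Word : Set
Word = List ℕ

IsPosWord : Word → Set
IsPosWord u = All (λ a → 1 ≤ a) u

InP : ℕ → Word → Set
InP n u = IsPosWord u × All (λ a → a ≤ n) u × (∀ k → 1 ≤ k → k ≤ n → k ∈ u)

Pred4 : Set₁
Pred4 = Word → ℕ → ℕ → Word → Set

data Step (P : Pred4) : Word → Word → Set where
  step : ∀ u a b v → 1 ≤ a → 1 ≤ b → IsPosWord u → IsPosWord v → P u a b v →
         Step P (u ++ a ∷ b ∷ v) (u ++ b ∷ a ∷ v)

_≡[_]_ : Word → Pred4 → Word → Set
u ≡[ P ] v = EqClosure (Step P) u v

CompatRelabel : Pred4 → Set
CompatRelabel P =
  ∀ (f : ℕ → ℕ) →
  (∀ a → 1 ≤ a → 1 ≤ f a) →
  (∀ a b → 1 ≤ a → a < b → f a < f b) →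
  ∀ u a b v → IsPosWord u → 1 ≤ a → 1 ≤ b → IsPosWord v →
  P u a b v → P (map f u) (f a) (f b) (map f v)

CompatSubword : Pred4 → Set
CompatSubword P =
  ∀ u u′ a b v v′ → IsPosWord u′ → 1 ≤ a → 1 ≤ b → IsPosWord v′ →
  u ⊑ u′ → v ⊑ v′ → P u a b v → P u′ a b v′

inc : ℕ → ℕ → Word → Word
inc α β = map (λ x → if β <ᵇ x then x + α else x)

compose : Word → ℕ → ℕ → Word → Word
compose u i m v =
  concatMap (λ x → if x ≡ᵇ i then inc (i ∸ 1) 0 v else x ∷ []) (inc (m ∸ 1) i u)

{-# OPTIONS --safe #-}
module Submission where

open import Defs
open import Data.Nat using (ℕ; zero; suc; _+_; _≤_; _<_; _<ᵇ_; _≡ᵇ_; z≤n; s≤s)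
open import Data.Nat.Properties
open import Data.Bool using (true; false; if_then_else_)
open import Data.List using ([]; _∷_; [_]; _++_; map; concatMap)
open import Data.List.Properties using (++-assoc; map-++; concatMap-++; concatMap-map)
open import Data.List.Relation.Unary.All as All using ([]; _∷_)
import Data.List.Relation.Unary.All.Properties as Allₚ
open import Data.List.Relation.Unary.Any using (here; there)
open import Data.List.Relation.Unary.Any.Properties using (singleton⁻)
open import Data.List.Membership.Propositional using (_∈_)
open import Data.List.Membership.Propositional.Properties using (∈-map⁺; ∈-map⁻)
open import Data.List.Relation.Binary.Sublist.Propositional
  using (⊆-refl; ⊆-trans; from∈) renaming (_⊆_ to _⊑_)
open import Data.List.Relation.Binary.Sublist.Propositional.Properties
  using (++⁺; ++⁺ˡ; ++⁺ʳ)
open import Data.Product using (Σ; _×_; _,_; proj₁; proj₂)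
open import Relation.Nullary using (yes; no; contradiction)
open import Relation.Nullary.Reflects using (ofʸ; ofⁿ)
open import Relation.Binary.Definitions using (tri<; tri≈; tri>)
open import Relation.Binary.PropositionalEquality using (_≡_; _≢_; refl; sym; trans; subst; subst₂)
open import Relation.Binary.Construct.Closure.ReflexiveTransitive using (ε; _◅◅_)
open import Relation.Binary.Construct.Closure.Equivalence
  using (setoid; isEquivalence; gmap; gfold; return)
import Relation.Binary.Reasoning.Setoid as SetoidReasoning

-- Relabelling a step by a strictly increasing map gives a step, which settles the
-- substitution of an equivalent word into the slot i.  For u ∘ᵢ v with u ≡ u′,
-- substituting v for i turns each swap a b ↦ b a of u into a sequence of swaps: the
-- block substituted for a moves letter by letter across the block substituted for b.
-- Each elementary swap c d is licensed by relabelling the instance P(x, a, b, y)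
-- along a strictly increasing map sending a ↦ c, b ↦ d and every other letter into
-- its own block; the relabelled x and y are then subwords of the current contexts.

record IsRelabeling (f : ℕ → ℕ) : Set where
  field
    pos  : ∀ a → 1 ≤ a → 1 ≤ f a
    mono : ∀ a b → 1 ≤ a → a < b → f a < f b

  map-pos : ∀ {u} → IsPosWord u → IsPosWord (map f u)
  map-pos pu = Allₚ.map⁺ (All.map (pos _) pu)

concatMap-pos : ∀ {σ : ℕ → Word} → (∀ {z} → 1 ≤ z → IsPosWord (σ z)) →
                ∀ {u} → IsPosWord u → IsPosWord (concatMap σ u)
concatMap-pos σ-pos pu = Allₚ.concat⁺ (Allₚ.map⁺ (All.map σ-pos pu))

module _ {P : Pred4} (CR : CompatRelabel P) {f : ℕ → ℕ} (rel : IsRelabeling f) where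
  open IsRelabeling rel

  relabel : ∀ {x a b y} → IsPosWord x → 1 ≤ a → 1 ≤ b → IsPosWord y →
            P x a b y → P (map f x) (f a) (f b) (map f y)
  relabel {x} {a} {b} {y} px pa pb py = CR f pos mono x a b y px pa pb py

  map-Step : ∀ {w w′} → Step P w w′ → Step P (map f w) (map f w′)
  map-Step (step x a b y pa pb px py p) =
    subst₂ (Step P) (sym (map-++ f x (a ∷ b ∷ y))) (sym (map-++ f x (b ∷ a ∷ y)))
      (step (map f x) (f a) (f b) (map f y) (pos a pa) (pos b pb) (map-pos px) (map-pos py)
        (relabel px pa pb py p))

  map-preserves-≡P : ∀ {w w′} → w ≡[ P ] w′ → map f w ≡[ P ] map f w′
  map-preserves-≡P = gmap (map f) map-Step

module _ {P : Pred4} (CS : CompatSubword P) where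

  Step-++ˡ : ∀ {L w w′} → IsPosWord L → Step P w w′ → Step P (L ++ w) (L ++ w′)
  Step-++ˡ {L} pL (step u a b v pa pb pu pv p) =
    subst₂ (Step P) (++-assoc L u (a ∷ b ∷ v)) (++-assoc L u (b ∷ a ∷ v))
      (step (L ++ u) a b v pa pb pLu pv (CS u (L ++ u) a b v v pLu pa pb pv (++⁺ˡ L ⊆-refl) ⊆-refl p))
    where
    pLu : IsPosWord (L ++ u)
    pLu = Allₚ.++⁺ pL pu

  Step-++ʳ : ∀ {R w w′} → IsPosWord R → Step P w w′ → Step P (w ++ R) (w′ ++ R)
  Step-++ʳ {R} pR (step u a b v pa pb pu pv p) =
    subst₂ (Step P) (sym (++-assoc u (a ∷ b ∷ v) R)) (sym (++-assoc u (b ∷ a ∷ v) R))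
      (step u a b (v ++ R) pa pb pu pvR (CS u u a b v (v ++ R) pu pa pb pvR ⊆-refl (++⁺ʳ R ⊆-refl) p))
    where
    pvR : IsPosWord (v ++ R)
    pvR = Allₚ.++⁺ pv pR

  ++-preserves-≡P : ∀ {w₁ w₁′ w₂ w₂′} → IsPosWord w₁′ → IsPosWord w₂ →
                    w₁ ≡[ P ] w₁′ → w₂ ≡[ P ] w₂′ → (w₁ ++ w₂) ≡[ P ] (w₁′ ++ w₂′)
  ++-preserves-≡P {w₁′ = w₁′} {w₂} pw₁′ pw₂ e₁ e₂ =
    gmap (_++ w₂) (Step-++ʳ pw₂) e₁ ◅◅ gmap (w₁′ ++_) (Step-++ˡ pw₁′) e₂

  concatMap-cong-≡P : ∀ {σ σ′ : ℕ → Word} →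
    (∀ {z} → 1 ≤ z → IsPosWord (σ z)) → (∀ {z} → 1 ≤ z → IsPosWord (σ′ z)) →
    (∀ {z} → σ z ≡[ P ] σ′ z) →
    ∀ {u} → IsPosWord u → concatMap σ u ≡[ P ] concatMap σ′ u
  concatMap-cong-≡P σ-pos σ′-pos σ≡σ′ [] = ε
  concatMap-cong-≡P σ-pos σ′-pos σ≡σ′ (pz ∷ pu) =
    ++-preserves-≡P (σ′-pos pz) (concatMap-pos σ-pos pu) σ≡σ′
      (concatMap-cong-≡P σ-pos σ′-pos σ≡σ′ pu)

Swappable : Pred4 → Word → Word → Word → Word → Set
Swappable P L A B R = ∀ {c d L′ R′} → c ∈ A → d ∈ B → L ⊑ L′ → R ⊑ R′ →
                      IsPosWord L′ → IsPosWord R′ → P L′ c d R′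

module _ {P : Pred4} where
  open SetoidReasoning (setoid (Step P))

  swap-letter-block : ∀ {L c B R} → Swappable P L [ c ] B R →
    IsPosWord L → 1 ≤ c → IsPosWord B → IsPosWord R →
    (L ++ c ∷ B ++ R) ≡[ P ] (L ++ B ++ c ∷ R)
  swap-letter-block {B = []} _ _ _ _ _ = ε
  swap-letter-block {L} {c} {d ∷ B} {R} sw pL pc (pd ∷ pB) pR = begin
    L ++ c ∷ d ∷ B ++ R         ≈⟨ return (step L c d (B ++ R) pc pd pL pBR swap-c-d) ⟩
    L ++ d ∷ c ∷ B ++ R         ≡⟨ ++-assoc L [ d ] _ ⟨
    (L ++ [ d ]) ++ c ∷ B ++ R  ≈⟨ swap-letter-block sw-B (Allₚ.++⁺ pL (pd ∷ [])) pc pB pR ⟩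
    (L ++ [ d ]) ++ B ++ c ∷ R  ≡⟨ ++-assoc L [ d ] _ ⟩
    L ++ d ∷ B ++ c ∷ R         ∎
    where
    pBR : IsPosWord (B ++ R)
    pBR = Allₚ.++⁺ pB pR
    swap-c-d : P L c d (B ++ R)
    swap-c-d = sw (here refl) (here refl) ⊆-refl (++⁺ˡ B ⊆-refl) pL pBR
    sw-B : Swappable P (L ++ [ d ]) [ c ] B R
    sw-B c∈ d∈ L⊑ = sw c∈ (there d∈) (⊆-trans (++⁺ʳ [ d ] ⊆-refl) L⊑)

  swap-blocks : ∀ {L A B R} → Swappable P L A B R →
    IsPosWord L → IsPosWord A → IsPosWord B → IsPosWord R →
    (L ++ A ++ B ++ R) ≡[ P ] (L ++ B ++ A ++ R)
  swap-blocks {A = []} _ _ _ _ _ = ε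
  swap-blocks {L} {c ∷ A} {B} {R} sw pL (pc ∷ pA) pB pR = begin
    L ++ c ∷ A ++ B ++ R         ≡⟨ ++-assoc L [ c ] _ ⟨
    (L ++ [ c ]) ++ A ++ B ++ R  ≈⟨ swap-blocks sw-A (Allₚ.++⁺ pL (pc ∷ [])) pA pB pR ⟩
    (L ++ [ c ]) ++ B ++ A ++ R  ≡⟨ ++-assoc L [ c ] _ ⟩
    L ++ c ∷ B ++ A ++ R         ≈⟨ swap-letter-block sw-c pL pc pB (Allₚ.++⁺ pA pR) ⟩
    L ++ B ++ c ∷ A ++ R         ∎
    where
    sw-A : Swappable P (L ++ [ c ]) A B R
    sw-A c∈ d∈ L⊑ = sw (there c∈) d∈ (⊆-trans (++⁺ʳ [ c ] ⊆-refl) L⊑)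
    sw-c : Swappable P L [ c ] B (A ++ R)
    sw-c c∈ d∈ L⊑ R⊑ = sw (here (singleton⁻ c∈)) d∈ L⊑ (⊆-trans (++⁺ˡ A ⊆-refl) R⊑)

record Selector (σ : ℕ → Word) : Set where
  field
    pick         : ℕ → ℕ
    isRelabeling : IsRelabeling pick
    pick-∈       : ∀ z → pick z ∈ σ z

  map-pick-⊑ : ∀ x → map pick x ⊑ concatMap σ x
  map-pick-⊑ []      = ⊆-refl
  map-pick-⊑ (z ∷ x) = ++⁺ (from∈ (pick-∈ z)) (map-pick-⊑ x)

Selectable : (ℕ → Word) → Set
Selectable σ = ∀ {a b c d} → a ≢ b → c ∈ σ a → d ∈ σ b →
               Σ (Selector σ) λ s → Selector.pick s a ≡ c × Selector.pick s b ≡ d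

module _ {P : Pred4} (CR : CompatRelabel P) (CS : CompatSubword P)
         {σ : ℕ → Word} (σ-selectable : Selectable σ)
         (σ-pos : ∀ {z} → 1 ≤ z → IsPosWord (σ z)) where
  open SetoidReasoning (setoid (Step P))

  concatMap-Step : ∀ {w w′} → Step P w w′ → concatMap σ w ≡[ P ] concatMap σ w′
  concatMap-Step (step x a b y pa pb px py p) with a ≟ b
  ... | yes refl = ε
  ... | no a≢b = begin
    concatMap σ (x ++ a ∷ b ∷ y)                     ≡⟨ concatMap-++ σ x _ ⟩
    concatMap σ x ++ σ a ++ σ b ++ concatMap σ y     ≈⟨ swap-blocks swappable
                                                          (concatMap-pos σ-pos px) (σ-pos pa)
                                                          (σ-pos pb) (concatMap-pos σ-pos py) ⟩
    concatMap σ x ++ σ b ++ σ a ++ concatMap σ y     ≡⟨ concatMap-++ σ x _ ⟨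
    concatMap σ (x ++ b ∷ a ∷ y)                     ∎
    where
    swappable : Swappable P (concatMap σ x) (σ a) (σ b) (concatMap σ y)
    swappable c∈ d∈ x⊑ y⊑ pL pR with σ-selectable a≢b c∈ d∈
    ... | s , refl , refl =
      CS (map pick x) _ (pick a) (pick b) (map pick y) _ pL (pos a pa) (pos b pb) pR
        (⊆-trans (map-pick-⊑ x) x⊑) (⊆-trans (map-pick-⊑ y) y⊑)
        (relabel CR isRelabeling px pa pb py p)
      where open Selector s
            open IsRelabeling isRelabeling

  concatMap-preserves-≡P : ∀ {w w′} → w ≡[ P ] w′ → concatMap σ w ≡[ P ] concatMap σ w′
  concatMap-preserves-≡P = gfold (isEquivalence (Step P)) (concatMap σ) concatMap-Step

-- inc α β = map (incLetter α β), so compose u i m v is definitionally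
-- concatMap (plug i (inc (i ∸ 1) 0 v)) (map (incLetter (m ∸ 1) i) u).
incLetter : ℕ → ℕ → ℕ → ℕ
incLetter α β x = if β <ᵇ x then x + α else x

plug : ℕ → Word → ℕ → Word
plug i W x = if x ≡ᵇ i then W else x ∷ []

≡ᵇ-refl : ∀ n → (n ≡ᵇ n) ≡ true
≡ᵇ-refl zero    = refl
≡ᵇ-refl (suc n) = ≡ᵇ-refl n

≢⇒≡ᵇ-false : ∀ {m n} → m ≢ n → (m ≡ᵇ n) ≡ false
≢⇒≡ᵇ-false {m} {n} m≢n with m ≡ᵇ n | ≡ᵇ⇒≡ m n
... | false | _   = refl
... | true  | m≡n = contradiction (m≡n _) m≢n

plug-pos : ∀ {i W z} → IsPosWord W → 1 ≤ z → IsPosWord (plug i W z)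
plug-pos {i} {W} {z} pW pz with z ≡ᵇ i
... | true  = pW
... | false = pz ∷ []

plug-≡P : ∀ {P i W W′ z} → W ≡[ P ] W′ → plug i W z ≡[ P ] plug i W′ z
plug-≡P {i = i} {z = z} W≡W′ with z ≡ᵇ i
... | true  = W≡W′
... | false = ε

inc-relabeling : ∀ k → IsRelabeling (incLetter k 0)
inc-relabeling k = record { pos = λ { (suc _) _ → s≤s z≤n }
                          ; mono = λ { (suc a) (suc b) _ a<b → +-monoˡ-< k a<b } }

inc-packed-∋ : ∀ {k m′ v} → InP (suc m′) v → suc k ∈ inc k 0 v
inc-packed-∋ {k} (_ , _ , all∈) = ∈-map⁺ (incLetter k 0) (all∈ 1 ≤-refl (s≤s z≤n))

inc-packed-range : ∀ {k m′ v c} → InP (suc m′) v → c ∈ inc k 0 v → suc k ≤ c × c ≤ suc k + m′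
inc-packed-range {k} {m′} (pv , v≤ , _) c∈ with ∈-map⁻ (incLetter k 0) c∈
... | zero , w∈ , _ = contradiction (All.lookup pv w∈) λ ()
... | suc w , w∈ , refl with All.lookup v≤ w∈
...   | s≤s w≤m′ = s≤s (m≤n+m k w) , s≤s (≤-trans (+-monoˡ-≤ k w≤m′) (≤-reflexive (+-comm m′ k)))

module Insertion (i m′ : ℕ) (V : Word) (1≤i : 1 ≤ i) (i∈V : i ∈ V)
                 (V-range : ∀ {c} → c ∈ V → i ≤ c × c ≤ i + m′) where

  shift : ℕ → ℕ
  shift = incLetter m′ i

  σ : ℕ → Word
  σ z = plug i V (shift z)

  pick : ℕ → ℕ → ℕ
  pick e z = if shift z ≡ᵇ i then e else shift z

  shift-≤ : ∀ {z} → z ≤ i → shift z ≡ z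
  shift-≤ {z} z≤i with i <ᵇ z | <ᵇ-reflects-< i z
  ... | false | _       = refl
  ... | true  | ofʸ i<z = contradiction z≤i (<⇒≱ i<z)

  shift-> : ∀ {z} → i < z → shift z ≡ z + m′
  shift-> {z} i<z with i <ᵇ z | <ᵇ-reflects-< i z
  ... | true  | _         = refl
  ... | false | ofⁿ i≮z   = contradiction i<z i≮z

  shift-≥ : ∀ z → z ≤ shift z
  shift-≥ z with z ≤? i
  ... | yes z≤i = ≤-reflexive (sym (shift-≤ z≤i))
  ... | no  z≰i = subst (z ≤_) (sym (shift-> (≰⇒> z≰i))) (m≤m+n z m′)

  shift-≢ : ∀ {z} → z ≢ i → shift z ≢ i
  shift-≢ {z} z≢i with z ≤? i
  ... | yes z≤i = subst (_≢ i) (sym (shift-≤ z≤i)) z≢i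
  ... | no  z≰i = subst (_≢ i) (sym (shift-> i<z)) (>⇒≢ (<-≤-trans i<z (m≤m+n z m′)))
    where
    i<z : i < z
    i<z = ≰⇒> z≰i

  shift-i : shift i ≡ i
  shift-i = shift-≤ ≤-refl

  σ-i : σ i ≡ V
  σ-i rewrite shift-i | ≡ᵇ-refl i = refl

  σ-≢ : ∀ {z} → z ≢ i → σ z ≡ [ shift z ]
  σ-≢ z≢i rewrite ≢⇒≡ᵇ-false (shift-≢ z≢i) = refl

  pick-i : ∀ {e} → pick e i ≡ e
  pick-i rewrite shift-i | ≡ᵇ-refl i = refl

  pick-≢ : ∀ {e z} → z ≢ i → pick e z ≡ shift z
  pick-≢ z≢i rewrite ≢⇒≡ᵇ-false (shift-≢ z≢i) = refl

  pick-≢-∈ : ∀ {e z c} → z ≢ i → c ∈ σ z → pick e z ≡ c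
  pick-≢-∈ z≢i c∈ = trans (pick-≢ z≢i) (sym (singleton⁻ (subst (_ ∈_) (σ-≢ z≢i) c∈)))

  pick-< : ∀ {e z} → z < i → pick e z ≡ z
  pick-< z<i = trans (pick-≢ (<⇒≢ z<i)) (shift-≤ (<⇒≤ z<i))

  pick-> : ∀ {e z} → i < z → pick e z ≡ z + m′
  pick-> i<z = trans (pick-≢ (>⇒≢ i<z)) (shift-> i<z)

  pick-≥ : ∀ {e} → i ≤ e → ∀ z → z ≤ pick e z
  pick-≥ i≤e z with z ≟ i
  ... | yes refl = subst (i ≤_) (sym pick-i) i≤e
  ... | no  z≢i  = subst (z ≤_) (sym (pick-≢ z≢i)) (shift-≥ z)

  pick-mono : ∀ {e} → i ≤ e → e ≤ i + m′ → ∀ {a b} → a < b → pick e a < pick e b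
  pick-mono {e} i≤e e≤ {a} {b} a<b with <-cmp a i
  ... | tri< a<i _ _ = subst (_< pick e b) (sym (pick-< a<i)) (<-≤-trans a<b (pick-≥ i≤e b))
  ... | tri≈ _ refl _ = subst₂ _<_ (sym pick-i) (sym (pick-> a<b)) (≤-<-trans e≤ (+-monoˡ-< m′ a<b))
  ... | tri> _ _ i<a = subst₂ _<_ (sym (pick-> i<a)) (sym (pick-> (<-trans i<a a<b)))
                         (+-monoˡ-< m′ a<b)

  selector : ∀ {e} → e ∈ V → Selector σ
  selector {e} e∈V = record
    { pick         = pick e
    ; isRelabeling = record
      { pos  = λ z 1≤z → ≤-trans 1≤z (pick-≥ i≤e z)
      ; mono = λ _ _ _ → pick-mono i≤e e≤ }
    ; pick-∈       = pick-∈ }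
    where
    i≤e : i ≤ e
    i≤e = proj₁ (V-range e∈V)
    e≤ : e ≤ i + m′
    e≤ = proj₂ (V-range e∈V)
    pick-∈ : ∀ z → pick e z ∈ σ z
    pick-∈ z with z ≟ i
    ... | yes refl = subst₂ _∈_ (sym pick-i) (sym σ-i) e∈V
    ... | no  z≢i  = subst₂ _∈_ (sym (pick-≢ z≢i)) (sym (σ-≢ z≢i)) (here refl)

  σ-selectable : Selectable σ
  σ-selectable {a} {b} a≢b c∈ d∈ with a ≟ i | b ≟ i
  ... | yes refl | yes refl = contradiction refl a≢b
  ... | yes refl | no  b≢i  = selector (subst (_ ∈_) σ-i c∈) , pick-i , pick-≢-∈ b≢i d∈
  ... | no  a≢i  | yes refl = selector (subst (_ ∈_) σ-i d∈) , pick-≢-∈ a≢i c∈ , pick-i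
  ... | no  a≢i  | no  b≢i  = selector i∈V , pick-≢-∈ a≢i c∈ , pick-≢-∈ b≢i d∈

  shift-pos : ∀ {z} → 1 ≤ z → 1 ≤ shift z
  shift-pos {z} 1≤z = ≤-trans 1≤z (shift-≥ z)

  map-shift-pos : ∀ {u} → IsPosWord u → IsPosWord (map shift u)
  map-shift-pos pu = Allₚ.map⁺ (All.map shift-pos pu)

  σ-pos : ∀ {z} → 1 ≤ z → IsPosWord (σ z)
  σ-pos 1≤z = plug-pos (All.tabulate λ c∈ → ≤-trans 1≤i (proj₁ (V-range c∈))) (shift-pos 1≤z)

theorem3p1 : (P : Pred4) → CompatRelabel P → CompatSubword P →
    ∀ (n m : ℕ) → 1 ≤ n → 1 ≤ m →
    ∀ u u′ → InP n u → InP n u′ → u ≡[ P ] u′ →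
    ∀ v v′ → InP m v → InP m v′ → v ≡[ P ] v′ →
    ∀ i → 1 ≤ i → i ≤ n →
    compose u i m v ≡[ P ] compose u′ i m v′
theorem3p1 P CR CS _ (suc m′) _ _ u u′ _ (pu′ , _) u≡u′ v v′ iv iv′ v≡v′ (suc k) 1≤i _ = begin
  compose u i m v           ≡⟨ concatMap-map (plug i V) shift u ⟩
  concatMap σ u             ≈⟨ concatMap-preserves-≡P CR CS σ-selectable σ-pos u≡u′ ⟩
  concatMap σ u′            ≡⟨ concatMap-map (plug i V) shift u′ ⟨
  compose u′ i m v          ≈⟨ concatMap-cong-≡P CS (plug-pos {i} pV) (plug-pos {i} pV′)
                                 (plug-≡P {i = i} V≡V′) (map-shift-pos pu′) ⟩
  compose u′ i m v′         ∎
  where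
  open SetoidReasoning (setoid (Step P))
  i m : ℕ
  i = suc k
  m = suc m′
  V V′ : Word
  V  = inc k 0 v
  V′ = inc k 0 v′
  V≡V′ : V ≡[ P ] V′
  V≡V′ = map-preserves-≡P CR (inc-relabeling k) v≡v′
  pV : IsPosWord V
  pV = IsRelabeling.map-pos (inc-relabeling k) (proj₁ iv)
  pV′ : IsPosWord V′
  pV′ = IsRelabeling.map-pos (inc-relabeling k) (proj₁ iv′)
  open Insertion i m′ V 1≤i (inc-packed-∋ iv) (inc-packed-range iv)
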